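{- Let $a,b,\chi$ be integers with $\chi\geq 3$, $\chi\geq b>1$ and $a\geq 2$, and suppose that either $\chi-b$ is even, or $\chi-b\geq 3$ is odd and $a>2$ is even. Then any graph $T^*_{a\chi+b,\chi}$ (constructed as described in the context) is an extremal $(a(\chi-1)+b-1\,|\,\chi)$-graph: it is $(a(\chi-1)+b-1)$-regular with chromatic number $\chi$, and every $(a(\chi-1)+b-1)$-regular graph with chromatic number $\chi$ has at least $a\chi+b$ vertices.
   Context: An $(r|\chi)$-graph is a simple finite $r$-regular graph with chromatic number $\chi$; it is extremal if it has minimum order among all $(r|\chi)$-graphs. Construction of $T^*_{n,\chi}$ with $n=a\chi+b$: start from the complete $\chi$-partite graph with parts $V_1,\dots,V_\chi$, where $|V_i|=a$ for $1\le i\le \chi-b$ and $|V_i|=a+1$ for $\chi-b<i\le\chi$ (two vertices adjacent iff in different parts). If $\chi-b$ is even, remove, for each $i\in\{1,3,5,\dots,\chi-b-1\}$, the edges of a perfect matching between $V_i$ and $V_{i+1}$. If $\chi-b\geq 3$ is odd and $a$ is even, split each of $V_1,V_2,V_3$ as $V_i=V_i'\cup V_i''$ with $|V_i'|=|V_i''|=a/2$, remove the edges of a perfect matching between $V_1'$ and $V_2''$, one between $V_2'$ and $V_3''$, and one between $V_3'$ and $V_1''$, and for each $i\in\{4,6,\dots,\chi-b-1\}$ remove the edges of a perfect matching between $V_i$ and $V_{i+1}$. The resulting graph is $T^*_{n,\chi}$. -}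

module Defs where

open import Data.Nat using (ℕ; zero; suc; _+_; _*_; _∸_; _≤_; _<_; _<ᵇ_; _≡ᵇ_)
open import Data.Nat.Divisibility using (_∣_)
open import Data.Nat.DivMod using (_/_)
open import Data.Fin using (Fin; toℕ) renaming (zero to fzero; suc to fsuc)
import Data.Fin as Fin
open import Data.Bool using (Bool; true; false; if_then_else_; not; _∧_)
open import Data.Product using (Σ; _×_)
open import Data.Sum using (_⊎_)
open import Relation.Nullary using (¬_; does)
open import Relation.Binary.PropositionalEquality using (_≡_; _≢_)

Adj : ℕ → Set
Adj n = Fin n → Fin n → Bool

IsSimple : ∀ {n} → Adj n → Set
IsSimple {n} adj = (∀ (u v : Fin n) → adj u v ≡ adj v u) × (∀ (v : Fin n) → adj v v ≡ false)

countᵇ : ∀ {n} → (Fin n → Bool) → ℕ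
countᵇ {zero}  p = 0
countᵇ {suc n} p = (if p fzero then 1 else 0) + countᵇ (λ v → p (fsuc v))

degree : ∀ {n} → Adj n → Fin n → ℕ
degree adj v = countᵇ (adj v)

Regular : ℕ → ∀ {n} → Adj n → Set
Regular r {n} adj = ∀ (v : Fin n) → degree adj v ≡ r

Colourable : ℕ → ∀ {n} → Adj n → Set
Colourable k {n} adj =
  Σ (Fin n → Fin k) λ c → ∀ (u v : Fin n) → adj u v ≡ true → c u ≢ c v

ChromaticNumber : ℕ → ∀ {n} → Adj n → Set
ChromaticNumber χ adj = Colourable χ adj × (∀ k → Colourable k adj → χ ≤ k)

RχGraph : ℕ → ℕ → ∀ {n} → Adj n → Set
RχGraph r χ adj = IsSimple adj × Regular r adj × ChromaticNumber χ adj

Extremal : ℕ → ℕ → ∀ {n} → Adj n → Set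
Extremal r χ {n} adj =
  RχGraph r χ adj × (∀ (m : ℕ) (adj' : Adj m) → RχGraph r χ adj' → n ≤ m)

Even : ℕ → Set
Even k = 2 ∣ k

Odd : ℕ → Set
Odd k = ¬ (2 ∣ k)

-- Parts are indexed 0..χ-1 (paper's V_{i+1} is our part i).
-- Parts i < χ ∸ b have size a, the others size a+1.
-- A perfect matching inside the union W of the small parts is encoded by
-- a partner function, an involution on W; removed edges are {v, partner v}.

order : ℕ → ℕ → ℕ → ℕ
order a b χ = a * χ + b

inPart : ∀ {n χ} → (Fin n → Fin χ) → Fin χ → Fin n → Bool
inPart part i v = does (part v Fin.≟ i)

inW : ∀ {n χ} → ℕ → (Fin n → Fin χ) → Fin n → Bool
inW s part v = toℕ (part v) <ᵇ s

tstarAdj : ∀ {n χ} → ℕ → (Fin n → Fin χ) → (Fin n → Fin n) → Adj n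
tstarAdj s part partner u v =
  not (does (part u Fin.≟ part v)) ∧ not (inW s part u ∧ does (partner u Fin.≟ v))

next3 : ℕ → ℕ
next3 p = if p ≡ᵇ 2 then 0 else suc p

record Partition (a b χ : ℕ) : Set where
  field
    part      : Fin (order a b χ) → Fin χ
    part-size : ∀ (i : Fin χ) →
      countᵇ (inPart part i) ≡ (if toℕ i <ᵇ (χ ∸ b) then a else suc a)
    partner   : Fin (order a b χ) → Fin (order a b χ)
    partner-inv : ∀ v → inW (χ ∸ b) part v ≡ true → partner (partner v) ≡ v

-- Case χ-b even: matchings between V_1,V_2; V_3,V_4; … (0-based 0,1; 2,3; …)
record EvenData (a b χ : ℕ) : Set where
  field
    P : Partition a b χ
  open Partition P
  field
    matched : ∀ v → inW (χ ∸ b) part v ≡ true →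
      (Even (toℕ (part v)) × toℕ (part (partner v)) ≡ suc (toℕ (part v)))
      ⊎ (Odd (toℕ (part v)) × suc (toℕ (part (partner v))) ≡ toℕ (part v))

-- Case χ-b ≥ 3 odd, a even: V_1,V_2,V_3 split in halves V' (half = true)
-- and V'' (half = false) of size a/2; matchings V_1'–V_2'', V_2'–V_3'',
-- V_3'–V_1''; and matchings V_4,V_5; V_6,V_7; … (0-based 3,4; 5,6; …)
record OddData (a b χ : ℕ) : Set where
  field
    P : Partition a b χ
  open Partition P
  field
    half : Fin (order a b χ) → Bool
    half-size′  : ∀ (i : Fin χ) → toℕ i < 3 →
      countᵇ (λ v → inPart part i v ∧ half v) ≡ a / 2
    half-size″ : ∀ (i : Fin χ) → toℕ i < 3 →
      countᵇ (λ v → inPart part i v ∧ not (half v)) ≡ a / 2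
    matched-′ : ∀ v → toℕ (part v) < 3 → half v ≡ true →
      toℕ (part (partner v)) ≡ next3 (toℕ (part v)) × half (partner v) ≡ false
    matched-″ : ∀ v → toℕ (part v) < 3 → half v ≡ false →
      next3 (toℕ (part (partner v))) ≡ toℕ (part v) × half (partner v) ≡ true
    matched-rest : ∀ v → inW (χ ∸ b) part v ≡ true → 3 ≤ toℕ (part v) →
      (Odd (toℕ (part v)) × toℕ (part (partner v)) ≡ suc (toℕ (part v)))
      ⊎ (Even (toℕ (part v)) × suc (toℕ (part (partner v))) ≡ toℕ (part v))

IsTStar : (a b χ : ℕ) → Adj (order a b χ) → Set
IsTStar a b χ adj =
  (Even (χ ∸ b) × Σ (EvenData a b χ) λ d →
     ∀ u v → adj u v ≡ tstarAdj (χ ∸ b) (Partition.part (EvenData.P d))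
                                  (Partition.partner (EvenData.P d)) u v)
  ⊎ (Odd (χ ∸ b) × 3 ≤ χ ∸ b × Even a × Σ (OddData a b χ) λ d →
     ∀ u v → adj u v ≡ tstarAdj (χ ∸ b) (Partition.part (OddData.P d))
                                  (Partition.partner (OddData.P d)) u v)

module Submission where

-- In an r-regular graph on m vertices with a proper
-- χ-colouring, every colour class lies in the non-neighbourhood of any of
-- its members, hence has at most m - r vertices; so m ≤ χ (m - r).  For
-- r = a(χ-1) + b - 1 with b ≥ 2 this forces m - r ≥ a + 1, i.e. m ≥ aχ + b.
--
-- For any partition into parts of the prescribed sizes and any
-- partner involution on the union W of the small parts that moves every
-- vertex to another part, T* is simple, every vertex has degree n - (a + 1)
-- (a vertex of W loses one neighbour, but its part is one smaller), and the
-- parts form a proper χ-colouring.  It has chromatic number exactly χ as soon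
-- as it contains a clique with one vertex in each part.  Such a clique is
-- built pair by pair: in parts matched in consecutive pairs (i, i+1) we take
-- any vertex of part i and a vertex of part i+1 other than its partner; in
-- the odd case the first three parts, matched cyclically, contribute one
-- vertex of each first half V'.

open import Defs
open import Data.Nat
open import Data.Nat.Properties
open import Data.Nat.Divisibility using (_∣_; _∣?_; divides; ∣1⇒≡1; ∣m+n∣m⇒∣n; ∣m∣n⇒∣m+n; ∣-refl)
open import Data.Nat.DivMod using (m≥n⇒m/n>0)
open import Data.Nat.Tactic.RingSolver using (solve)
open import Data.List using (_∷_; [])
open import Data.Fin using (Fin; toℕ) renaming (zero to fzero; suc to fsuc)
import Data.Fin as Fin
open import Data.Fin.Properties using (toℕ<n; toℕ-injective; toℕ-inject₁; injective⇒≤)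
open import Data.Bool using (Bool; true; false; if_then_else_; not; _∧_)
import Data.Bool
open import Data.Bool.Properties using (∧-identityʳ; ∧-zeroʳ; ¬-not)
open import Data.Product using (Σ; _×_; _,_; proj₁; proj₂)
open import Data.Sum using (_⊎_; inj₁; inj₂)
open import Data.Empty using (⊥-elim)
open import Relation.Nullary using (¬_; Dec; yes; no; does; contradiction; ¬?)
open import Relation.Nullary.Decidable using (dec-true; dec-false)
open import Relation.Unary using (Decidable)
open import Relation.Binary.PropositionalEquality
open import Function using (_∘_)

does⇒ : ∀ {ℓ} {A : Set ℓ} (d : Dec A) → does d ≡ true → A
does⇒ (yes a) _ = a

not-does⇒¬ : ∀ {ℓ} {A : Set ℓ} (d : Dec A) → not (does d) ≡ true → ¬ A
not-does⇒¬ (no ¬a) _ = ¬a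

∧-true : ∀ {x y : Bool} → (x ∧ y) ≡ true → x ≡ true × y ≡ true
∧-true {true} {true} _ = refl , refl

false⇒not-true : ∀ {x : Bool} → x ≡ false → not x ≡ true
false⇒not-true refl = refl

count-cong : ∀ {n} {p q : Fin n → Bool} → (∀ u → p u ≡ q u) → countᵇ p ≡ countᵇ q
count-cong {zero} e = refl
count-cong {suc n} {p} {q} e rewrite e fzero =
  cong (_ +_) (count-cong {p = λ u → p (fsuc u)} {q = λ u → q (fsuc u)} (λ u → e (fsuc u)))

indicator-mono : ∀ {x y : Bool} → (x ≡ true → y ≡ true) →
  (if x then 1 else 0) ≤ (if y then 1 else 0)
indicator-mono {false} {y}     x⇒y = z≤n
indicator-mono {true}  {true}  x⇒y = ≤-refl
indicator-mono {true}  {false} x⇒y with () ← x⇒y refl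

count-mono : ∀ {n} {p q : Fin n → Bool} → (∀ u → p u ≡ true → q u ≡ true) →
  countᵇ p ≤ countᵇ q
count-mono {zero} p⊆q = z≤n
count-mono {suc n} {p} {q} p⊆q = +-mono-≤ (indicator-mono (p⊆q fzero))
  (count-mono {p = λ u → p (fsuc u)} {q = λ u → q (fsuc u)} (λ u → p⊆q (fsuc u)))

count-split : ∀ {n} (p q : Fin n → Bool) →
  countᵇ p ≡ countᵇ (λ u → p u ∧ q u) + countᵇ (λ u → p u ∧ not (q u))
count-split {zero} p q = refl
count-split {suc n} p q with p fzero | q fzero
... | true  | true  = cong suc (count-split (λ u → p (fsuc u)) (λ u → q (fsuc u)))
... | true  | false = trans (cong suc (count-split (λ u → p (fsuc u)) (λ u → q (fsuc u))))
                            (sym (+-suc _ _))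
... | false | _     = count-split (λ u → p (fsuc u)) (λ u → q (fsuc u))

count-all : ∀ {n} → countᵇ {n} (λ _ → true) ≡ n
count-all {zero} = refl
count-all {suc n} = cong suc (count-all {n})

count-not : ∀ {n} (p : Fin n → Bool) → countᵇ (λ u → not (p u)) ≡ n ∸ countᵇ p
count-not {n} p = begin
  countᵇ (λ u → not (p u))                          ≡⟨ sym (m+n∸m≡n (countᵇ p) _) ⟩
  countᵇ p + countᵇ (λ u → not (p u)) ∸ countᵇ p  ≡⟨ cong (_∸ countᵇ p) (sym (count-split {n} (λ _ → true) p)) ⟩
  countᵇ {n} (λ _ → true) ∸ countᵇ p                ≡⟨ cong (_∸ countᵇ p) (count-all {n}) ⟩
  n ∸ countᵇ p                                      ∎
  where open ≡-Reasoning

count-witness : ∀ {n} (p : Fin n → Bool) → 0 < countᵇ p → Σ (Fin n) λ v → p v ≡ true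
count-witness {suc n} p pos with p fzero in p0
... | true  = fzero , p0
... | false with u , pu ← count-witness (λ u → p (fsuc u)) pos = fsuc u , pu

count-bound-by-member : ∀ {n} B (p : Fin n → Bool) →
  (∀ v → p v ≡ true → countᵇ p ≤ B) → countᵇ p ≤ B
count-bound-by-member B p bound with countᵇ p in cnt
... | zero  = z≤n
... | suc _ with v , pv ← count-witness p (subst (0 <_) (sym cnt) z<s) = bound v pv

count-none : ∀ {n} → countᵇ {n} (λ _ → false) ≡ 0
count-none {zero}  = refl
count-none {suc n} = count-none {n}

count-single : ∀ {n} (w : Fin n) → countᵇ (λ u → does (w Fin.≟ u)) ≡ 1
count-single {suc n} fzero    = cong suc (count-none {n})
count-single {suc n} (fsuc w) = count-single w

count-remove : ∀ {n} (q : Fin n → Bool) (w : Fin n) → q w ≡ true →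
  countᵇ q ≡ suc (countᵇ (λ u → q u ∧ not (does (w Fin.≟ u))))
count-remove q w qw = trans (count-split q (λ u → does (w Fin.≟ u)))
  (cong (_+ countᵇ (λ u → q u ∧ not (does (w Fin.≟ u)))) (trans (count-cong only-w) (count-single w)))
  where
  only-w : ∀ u → (q u ∧ does (w Fin.≟ u)) ≡ does (w Fin.≟ u)
  only-w u with w Fin.≟ u
  ... | yes refl = trans (∧-identityʳ (q u)) qw
  ... | no _     = ∧-zeroʳ (q u)

member-other-than : ∀ {n} (q : Fin n → Bool) (w : Fin n) → 2 ≤ countᵇ q →
  Σ (Fin n) λ v → q v ≡ true × v ≢ w
member-other-than q w two =
  let (v , e) = count-witness others others-nonempty
      (qv , v≢w) = ∧-true e
  in v , qv , λ v≡w → not-does⇒¬ (w Fin.≟ v) v≢w (sym v≡w)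
  where
  others : _ → Bool
  others u = q u ∧ not (does (w Fin.≟ u))
  at-w-only : countᵇ (λ u → q u ∧ does (w Fin.≟ u)) ≤ 1
  at-w-only = ≤-trans (count-mono {p = λ u → q u ∧ does (w Fin.≟ u)} (λ u e → proj₂ (∧-true e)))
                      (≤-reflexive (count-single w))
  others-nonempty : 0 < countᵇ others
  others-nonempty = +-cancelˡ-≤ 1 1 (countᵇ others) (begin
    2                                                         ≤⟨ two ⟩
    countᵇ q                                                  ≡⟨ count-split q _ ⟩
    countᵇ (λ u → q u ∧ does (w Fin.≟ u)) + countᵇ others    ≤⟨ +-monoˡ-≤ (countᵇ others) at-w-only ⟩
    1 + countᵇ others                                         ∎)
    where open ≤-Reasoning

count-by-colour : ∀ {m} k B (col : Fin m → ℕ) (P : Fin m → Bool) →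
  (∀ u → P u ≡ true → col u < k) →
  (∀ c → c < k → countᵇ (λ u → P u ∧ does (col u ≟ c)) ≤ B) →
  countᵇ P ≤ k * B
count-by-colour {m} zero B col P col<0 class≤B =
  ≤-reflexive (trans (count-cong none) (count-none {m}))
  where
  none : ∀ u → P u ≡ false
  none u = ¬-not (λ Pu → n≮0 (col<0 u Pu))
count-by-colour (suc k) B col P col<k+1 class≤B = begin
  countᵇ P                                        ≡⟨ count-split P (λ u → does (col u ≟ k)) ⟩
  countᵇ (λ u → P u ∧ does (col u ≟ k)) + countᵇ P′ ≤⟨ +-mono-≤ (class≤B k ≤-refl) rest ⟩
  B + k * B                                       ∎
  where
  open ≤-Reasoning
  P′ : _ → Bool
  P′ u = P u ∧ not (does (col u ≟ k))
  P′⊆P : ∀ u → P′ u ≡ true → P u ≡ true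
  P′⊆P u e = proj₁ (∧-true e)
  col<k : ∀ u → P′ u ≡ true → col u < k
  col<k u e = ≤∧≢⇒< (≤-pred (col<k+1 u (P′⊆P u e))) (not-does⇒¬ (col u ≟ k) (proj₂ (∧-true e)))
  class-in-P′⊆class-in-P : ∀ c u → (P′ u ∧ does (col u ≟ c)) ≡ true → (P u ∧ does (col u ≟ c)) ≡ true
  class-in-P′⊆class-in-P c u e with P′u , col≡c ← ∧-true e =
    trans (cong (_∧ does (col u ≟ c)) (P′⊆P u P′u)) col≡c
  rest : countᵇ P′ ≤ k * B
  rest = count-by-colour k B col P′ col<k λ c c<k →
    ≤-trans (count-mono (class-in-P′⊆class-in-P c)) (class≤B c (m≤n⇒m≤1+n c<k))

-- In a proper colouring of an r-regular graph on m vertices, a colour class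
-- lies in the non-neighbourhood of each of its members, so it has at most
-- m ∸ r vertices.
colour-class-bound : ∀ {m r k} (adj : Adj m) → Regular r adj →
  (c : Fin m → Fin k) → (∀ u v → adj u v ≡ true → c u ≢ c v) →
  ∀ i → countᵇ (λ u → does (toℕ (c u) ≟ i)) ≤ m ∸ r
colour-class-bound {m} {r} adj reg c proper i =
  count-bound-by-member (m ∸ r) _ λ v cv≡i → begin
    countᵇ (λ u → does (toℕ (c u) ≟ i)) ≤⟨ count-mono (λ u cu≡i → false⇒not-true (non-adjacent v u cv≡i cu≡i)) ⟩
    countᵇ (λ u → not (adj v u))        ≡⟨ count-not (adj v) ⟩
    m ∸ degree adj v                     ≡⟨ cong (m ∸_) (reg v) ⟩
    m ∸ r                                ∎
  where
  open ≤-Reasoning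
  non-adjacent : ∀ v u → does (toℕ (c v) ≟ i) ≡ true → does (toℕ (c u) ≟ i) ≡ true →
    adj v u ≡ false
  non-adjacent v u cv≡i cu≡i = ¬-not λ vu → proper v u vu
    (toℕ-injective (trans (does⇒ (toℕ (c v) ≟ i) cv≡i) (sym (does⇒ (toℕ (c u) ≟ i) cu≡i))))

order-bound : ∀ {m r χ} (adj : Adj m) → Regular r adj → Colourable χ adj → m ≤ χ * (m ∸ r)
order-bound {m} {r} {χ} adj reg (c , proper) = subst (_≤ χ * (m ∸ r)) (count-all {m})
  (count-by-colour χ (m ∸ r) (λ u → toℕ (c u)) (λ _ → true)
     (λ u _ → toℕ<n (c u)) (λ i _ → colour-class-bound adj reg c proper i))

-- The arithmetic behind the lower bound: with χ = c + 1 colours and degree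
-- r = a c + d where d ≥ 1, the inequality m ≤ χ (m ∸ r) for m > 0 forces
-- m ∸ r > a and hence m ≥ a χ + d + 1.
order-bound-arith : ∀ a c d m → 1 ≤ d → 0 < m →
  m ≤ suc c * (m ∸ (a * c + d)) → a * suc c + suc d ≤ m
order-bound-arith a c d m 1≤d 0<m m≤χt = begin
  a * suc c + suc d   ≡⟨ solve (a ∷ c ∷ d ∷ []) ⟩
  a * c + d + suc a   ≤⟨ +-monoʳ-≤ r a<t ⟩
  r + t               ≡⟨ r+t≡m ⟩
  m                   ∎
  where
  open ≤-Reasoning
  r = a * c + d
  t = m ∸ r
  -- otherwise m ∸ r = 0 and m ≤ 0
  r<m : r < m
  r<m = ≰⇒> λ m≤r → <⇒≱ 0<m
    (subst (m ≤_) (trans (cong (suc c *_) (m≤n⇒m∸n≡0 m≤r)) (*-zeroʳ (suc c))) m≤χt)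
  r+t≡m : r + t ≡ m
  r+t≡m = m+[n∸m]≡n (<⇒≤ r<m)
  r≤ct : r ≤ c * t
  r≤ct = +-cancelʳ-≤ t r (c * t) (subst₂ _≤_ (sym r+t≡m) (+-comm t (c * t)) m≤χt)
  a<t : a < t
  a<t = ≰⇒> λ t≤a → <⇒≱ (begin-strict
    c * t  ≤⟨ *-monoʳ-≤ c t≤a ⟩
    c * a  ≡⟨ *-comm c a ⟩
    a * c  <⟨ m<m+n (a * c) 1≤d ⟩
    r      ∎) r≤ct

true-iff⇒≡ : ∀ {x y : Bool} → (x ≡ true → y ≡ true) → (y ≡ true → x ≡ true) → x ≡ y
true-iff⇒≡ {false} {false} _ _ = refl
true-iff⇒≡ {false} {true}  _ y⇒x = y⇒x refl
true-iff⇒≡ {true}  {_}     x⇒y _ = sym (x⇒y refl)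

does-≟-sym : ∀ {n} (x y : Fin n) → does (x Fin.≟ y) ≡ does (y Fin.≟ x)
does-≟-sym x y = true-iff⇒≡ (λ e → dec-true (y Fin.≟ x) (sym (does⇒ (x Fin.≟ y) e)))
                            (λ e → dec-true (x Fin.≟ y) (sym (does⇒ (y Fin.≟ x) e)))

RχGraph-cong : ∀ {m r χ} {adj adj′ : Adj m} → (∀ u v → adj u v ≡ adj′ u v) →
  RχGraph r χ adj′ → RχGraph r χ adj
RχGraph-cong {adj = adj} {adj′} e ((sym′ , loopless′) , regular′ , (c , proper′) , minimal′) =
  (symmetric , loopless) , regular , (c , proper) , minimal
  where
  symmetric : ∀ u v → adj u v ≡ adj v u
  symmetric u v = trans (e u v) (trans (sym′ u v) (sym (e v u)))
  loopless : ∀ v → adj v v ≡ false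
  loopless v = trans (e v v) (loopless′ v)
  regular : Regular _ adj
  regular v = trans (count-cong (e v)) (regular′ v)
  proper : ∀ u v → adj u v ≡ true → c u ≢ c v
  proper u v uv = proper′ u v (trans (sym (e u v)) uv)
  minimal : ∀ k → Colourable k adj → _ ≤ k
  minimal k (c′ , proper-c′) = minimal′ k (c′ , λ u v uv → proper-c′ u v (trans (e u v) uv))

-- A χ-colourable graph containing a clique on χ vertices has chromatic
-- number χ, since every proper colouring is injective on the clique.
chromatic-from-clique : ∀ {n χ} (adj : Adj n) → Colourable χ adj →
  (f : Fin χ → Fin n) → (∀ i j → i ≢ j → adj (f i) (f j) ≡ true) →
  ChromaticNumber χ adj
chromatic-from-clique adj colourable f clique = colourable , at-least-χ
  where
  at-least-χ : ∀ k → Colourable k adj → _ ≤ k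
  at-least-χ k (c , proper) = injective⇒≤ {f = λ i → c (f i)} injective
    where
    injective : ∀ {i j} → c (f i) ≡ c (f j) → i ≡ j
    injective {i} {j} same-colour with i Fin.≟ j
    ... | yes i≡j = i≡j
    ... | no  i≢j = ⊥-elim (proper (f i) (f j) (clique i j i≢j) same-colour)

module TStar {a b χ : ℕ} (P : Partition a b χ) where
  open Partition P

  s : ℕ
  s = χ ∸ b

  n : ℕ
  n = order a b χ

  T : Adj n
  T = tstarAdj s part partner

  record GoodMatching : Set where
    field
      partner-in-W  : ∀ v → inW s part v ≡ true → inW s part (partner v) ≡ true
      partner-moves : ∀ v → inW s part v ≡ true → part (partner v) ≢ part v

  record UnmatchedTransversal : Set where
    field
      rep           : Fin χ → Fin n
      rep-part      : ∀ i → part (rep i) ≡ i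
      rep-unmatched : ∀ i j → i ≢ j → inW s part (rep i) ≡ true → partner (rep i) ≢ rep j

  other-part : Fin n → Fin n → Bool
  other-part u v = not (does (part u Fin.≟ part v))

  removed : Fin n → Fin n → Bool
  removed u v = inW s part u ∧ does (partner u Fin.≟ v)

  adjacent : ∀ u v → part u ≢ part v → (inW s part u ≡ true → partner u ≢ v) → T u v ≡ true
  adjacent u v parts-differ unmatched rewrite dec-false (part u Fin.≟ part v) parts-differ
    with inW s part u
  ... | false = refl
  ... | true rewrite dec-false (partner u Fin.≟ v) (unmatched refl) = refl

  colourable : Colourable χ T
  colourable = part , λ u v uv → not-does⇒¬ (part u Fin.≟ part v) (proj₁ (∧-true uv))

  other-part-count : ∀ v → countᵇ (other-part v) ≡ n ∸ (if inW s part v then a else suc a)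
  other-part-count v = begin
    countᵇ (other-part v)                       ≡⟨ count-cong (λ u → cong not (does-≟-sym (part v) (part u))) ⟩
    countᵇ (λ u → not (inPart part (part v) u)) ≡⟨ count-not (inPart part (part v)) ⟩
    n ∸ countᵇ (inPart part (part v))           ≡⟨ cong (n ∸_) (part-size (part v)) ⟩
    n ∸ (if inW s part v then a else suc a)     ∎
    where open ≡-Reasoning

  module _ (M : GoodMatching) where
    open GoodMatching M

    removed-sym : ∀ u v → removed u v ≡ true → removed v u ≡ true
    removed-sym u v uv with u∈W , partner≡ ← ∧-true {inW s part u} uv
      with refl ← does⇒ (partner u Fin.≟ v) partner≡
      rewrite partner-in-W u u∈W = dec-true (partner (partner u) Fin.≟ u) (partner-inv u u∈W)

    simple : IsSimple T
    simple = symmetric , loopless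
      where
      symmetric : ∀ u v → T u v ≡ T v u
      symmetric u v = cong₂ _∧_ (cong not (does-≟-sym (part u) (part v)))
                                (cong not (true-iff⇒≡ (removed-sym u v) (removed-sym v u)))
      loopless : ∀ v → T v v ≡ false
      loopless v rewrite dec-true (part v Fin.≟ part v) refl = refl

    -- A vertex of W loses its partner, but its part has only a vertices;
    -- either way the degree is n ∸ (a + 1).
    regular : Regular (n ∸ suc a) T
    regular v with inW s part v in v∈W
    ... | true = begin
      countᵇ (λ u → other-part v u ∧ not (does (partner v Fin.≟ u)))
        ≡⟨ cong pred (sym (count-remove (other-part v) (partner v) partner-elsewhere)) ⟩
      pred (countᵇ (other-part v))  ≡⟨ cong pred (other-part-count v) ⟩
      pred (n ∸ (if inW s part v then a else suc a)) ≡⟨ cong (λ x → pred (n ∸ (if x then a else suc a))) v∈W ⟩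
      pred (n ∸ a)                  ≡⟨ pred[m∸n]≡m∸[1+n] n a ⟩
      n ∸ suc a                     ∎
      where
      open ≡-Reasoning
      partner-elsewhere : other-part v (partner v) ≡ true
      partner-elsewhere = false⇒not-true
        (dec-false (part v Fin.≟ part (partner v)) (≢-sym (partner-moves v v∈W)))
    ... | false = begin
      countᵇ (λ u → other-part v u ∧ true) ≡⟨ count-cong (λ u → ∧-identityʳ (other-part v u)) ⟩
      countᵇ (other-part v)                ≡⟨ other-part-count v ⟩
      n ∸ (if inW s part v then a else suc a) ≡⟨ cong (λ x → n ∸ (if x then a else suc a)) v∈W ⟩
      n ∸ suc a                            ∎
      where open ≡-Reasoning

    is-RχGraph : UnmatchedTransversal → RχGraph (n ∸ suc a) χ T
    is-RχGraph t = simple , regular , chromatic-from-clique T colourable rep clique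
      where
      open UnmatchedTransversal t
      clique : ∀ i j → i ≢ j → T (rep i) (rep j) ≡ true
      clique i j i≢j = adjacent (rep i) (rep j)
        (λ same → i≢j (trans (sym (rep-part i)) (trans same (rep-part j))))
        (rep-unmatched i j i≢j)

<ᵇ-true⇒< : ∀ {m n} → (m <ᵇ n) ≡ true → m < n
<ᵇ-true⇒< {m} {n} e = <ᵇ⇒< m n (subst Data.Bool.T (sym e) _)

<⇒<ᵇ-true : ∀ {m n} → m < n → (m <ᵇ n) ≡ true
<⇒<ᵇ-true {m} {n} m<n with m <ᵇ n | <⇒<ᵇ m<n
... | true | _ = refl

toℕ-pred : ∀ {n} (i : Fin n) → toℕ (Fin.pred i) ≡ toℕ i ∸ 1
toℕ-pred fzero    = refl
toℕ-pred (fsuc i) = toℕ-inject₁ i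

-- Parts p and q are matched as a consecutive pair, p being the first member
-- of the pair exactly when Low p.
Paired : (Low : ℕ → Set) → ℕ → ℕ → Set
Paired Low p q = (Low p × q ≡ suc p) ⊎ (¬ Low p × suc q ≡ p)

module Pairing {a b χ : ℕ} (P : Partition a b χ) (2≤a : 2 ≤ a) where
  open Partition P
  open TStar P

  part-size≥2 : ∀ i → 2 ≤ countᵇ (inPart part i)
  part-size≥2 i rewrite part-size i with toℕ i <ᵇ s
  ... | true  = 2≤a
  ... | false = m≤n⇒m≤1+n 2≤a

  some-in : Fin χ → Fin n
  some-in i = proj₁ (count-witness (inPart part i) (≤-trans (s≤s z≤n) (part-size≥2 i)))

  some-in-part : ∀ i → part (some-in i) ≡ i
  some-in-part i = does⇒ (part (some-in i) Fin.≟ i)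
    (proj₂ (count-witness (inPart part i) (≤-trans (s≤s z≤n) (part-size≥2 i))))

  other-in : Fin χ → Fin n → Fin n
  other-in i w = proj₁ (member-other-than (inPart part i) w (part-size≥2 i))

  other-in-part : ∀ i w → part (other-in i w) ≡ i
  other-in-part i w = does⇒ (part (other-in i w) Fin.≟ i)
    (proj₁ (proj₂ (member-other-than (inPart part i) w (part-size≥2 i))))

  other-in-≢ : ∀ i w → other-in i w ≢ w
  other-in-≢ i w = proj₂ (proj₂ (member-other-than (inPart part i) w (part-size≥2 i)))

  -- An unmatched transversal for a matching that, from part o on, joins
  -- parts only in consecutive pairs (p, p + 1) starting at the parts p with
  -- Low p; Low alternates, part o starts a pair and W ends before a new pair
  -- (Low s).  Below part o, representatives head i are given whose partners
  -- stay below o and are never representatives themselves.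
  module Pairs (o : ℕ) (Low : ℕ → Set) (Low? : Decidable Low)
    (low-suc   : ∀ p → Low p → ¬ Low (suc p))
    (low-pred  : ∀ p → ¬ Low (suc p) → Low p)
    (low-start : Low o)
    (low-end   : Low s)
    (paired    : ∀ v → inW s part v ≡ true → o ≤ toℕ (part v) →
                   Paired Low (toℕ (part v)) (toℕ (part (partner v))))
    (head      : ∀ i → toℕ i < o → Fin n)
    (head-part : ∀ i i<o → part (head i i<o) ≡ i)
    (head-partner-below : ∀ i i<o → toℕ (part (partner (head i i<o))) < o)
    (head-unmatched : ∀ i j i<o j<o → partner (head i i<o) ≢ head j j<o)
    where

    -- Below o use the given representatives; the first member of a pair gets
    -- any vertex, the second one a vertex avoiding the partner of the first.
    rep-by : (i : Fin χ) → Dec (toℕ i < o) → Dec (Low (toℕ i)) → Fin n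
    rep-by i (yes i<o) _       = head i i<o
    rep-by i (no _)    (yes _) = some-in i
    rep-by i (no _)    (no _)  = other-in i (partner (some-in (Fin.pred i)))

    rep : Fin χ → Fin n
    rep i = rep-by i (toℕ i <? o) (Low? (toℕ i))

    rep-part : ∀ i → part (rep i) ≡ i
    rep-part i with toℕ i <? o | Low? (toℕ i)
    ... | yes i<o | _     = head-part i i<o
    ... | no _    | yes _ = some-in-part i
    ... | no _    | no _  = other-in-part i _

    rep-head : ∀ i (i<o : toℕ i < o) → rep i ≡ head i i<o
    rep-head i i<o with toℕ i <? o
    ... | yes i<o′ = cong (head i) (<-irrelevant i<o′ i<o)
    ... | no  i≮o  = contradiction i<o i≮o

    rep-low : ∀ i → o ≤ toℕ i → Low (toℕ i) → rep i ≡ some-in i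
    rep-low i o≤i low with toℕ i <? o | Low? (toℕ i)
    ... | yes i<o | _        = contradiction o≤i (<⇒≱ i<o)
    ... | no _    | yes _    = refl
    ... | no _    | no ¬low  = contradiction low ¬low

    rep-high : ∀ i → o ≤ toℕ i → ¬ Low (toℕ i) → rep i ≡ other-in i (partner (some-in (Fin.pred i)))
    rep-high i o≤i ¬low with toℕ i <? o | Low? (toℕ i)
    ... | yes i<o | _        = contradiction o≤i (<⇒≱ i<o)
    ... | no _    | yes low  = contradiction low ¬low
    ... | no _    | no _     = refl

    tail-in-W : ∀ v → inW s part v ≡ true → o ≤ toℕ (part v) → inW s part (partner v) ≡ true
    tail-in-W v v∈W o≤v with v<s ← <ᵇ-true⇒< v∈W | paired v v∈W o≤v
    ... | inj₁ (low , q≡p+1) = <⇒<ᵇ-true (subst (_< s) (sym q≡p+1) (≤∧≢⇒< v<s p+1≢s))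
      where
      p+1≢s : suc (toℕ (part v)) ≢ s
      p+1≢s p+1≡s = low-suc _ low (subst Low (sym p+1≡s) low-end)
    ... | inj₂ (_ , q+1≡p)   = <⇒<ᵇ-true (<-trans (subst (toℕ (part (partner v)) <_) q+1≡p (n<1+n _)) v<s)

    tail-moves : ∀ v → inW s part v ≡ true → o ≤ toℕ (part v) → part (partner v) ≢ part v
    tail-moves v v∈W o≤v same with paired v v∈W o≤v
    ... | inj₁ (_ , q≡p+1) = 1+n≢n (trans (sym q≡p+1) (cong toℕ same))
    ... | inj₂ (_ , q+1≡p) = 1+n≢n (trans (cong (suc ∘ toℕ) (sym same)) q+1≡p)

    low-pair-unmatched : ∀ i j → o ≤ toℕ i → Low (toℕ i) → toℕ j ≡ suc (toℕ i) →
      partner (rep i) ≢ rep j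
    low-pair-unmatched i j o≤i low j≡i+1 partner≡ = other-in-≢ j _ (begin
      other-in j (partner (some-in (Fin.pred j))) ≡⟨ sym (rep-high j o≤j ¬low-j) ⟩
      rep j                                       ≡⟨ sym partner≡ ⟩
      partner (rep i)                             ≡⟨ cong partner (rep-low i o≤i low) ⟩
      partner (some-in i)                         ≡⟨ cong (partner ∘ some-in) (sym pred-j≡i) ⟩
      partner (some-in (Fin.pred j))              ∎)
      where
      open ≡-Reasoning
      o≤j : o ≤ toℕ j
      o≤j = ≤-trans o≤i (subst (toℕ i ≤_) (sym j≡i+1) (n≤1+n _))
      ¬low-j : ¬ Low (toℕ j)
      ¬low-j low-j = low-suc _ low (subst Low j≡i+1 low-j)
      pred-j≡i : Fin.pred j ≡ i
      pred-j≡i = toℕ-injective (trans (toℕ-pred j) (cong (_∸ 1) j≡i+1))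

    paired-reps : ∀ i j → inW s part (rep i) ≡ true → o ≤ toℕ i →
      partner (rep i) ≡ rep j → Paired Low (toℕ i) (toℕ j)
    paired-reps i j i∈W o≤i partner≡ =
      subst₂ (Paired Low) (cong toℕ (rep-part i)) (cong toℕ (trans (cong part partner≡) (rep-part j)))
        (paired (rep i) i∈W (subst (o ≤_) (sym (cong toℕ (rep-part i))) o≤i))

    -- From o on, a removed edge between representatives joins the two members
    -- of a pair; read from its first member it contradicts low-pair-unmatched.
    tail-rep-unmatched : ∀ i j → o ≤ toℕ i → inW s part (rep i) ≡ true → partner (rep i) ≢ rep j
    tail-rep-unmatched i j o≤i i∈W partner≡ with paired-reps i j i∈W o≤i partner≡
    ... | inj₁ (low , j≡i+1)  = low-pair-unmatched i j o≤i low j≡i+1 partner≡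
    ... | inj₂ (¬low , j+1≡i) = low-pair-unmatched j i o≤j low-j (sym j+1≡i) partner-j≡
      where
      -- i is the second member of the pair (j, i), so j ≥ o since part o is a first member.
      o≤j : o ≤ toℕ j
      o≤j with m≤n⇒m<n∨m≡n o≤i
      ... | inj₁ o<i = ≤-pred (subst (o <_) (sym j+1≡i) o<i)
      ... | inj₂ o≡i = contradiction (subst Low o≡i low-start) ¬low
      low-j : Low (toℕ j)
      low-j = low-pred _ (λ low-j+1 → ¬low (subst Low j+1≡i low-j+1))
      partner-j≡ : partner (rep j) ≡ rep i
      partner-j≡ = trans (cong partner (sym partner≡)) (partner-inv (rep i) i∈W)

    head-rep-unmatched : ∀ i j → toℕ i < o → partner (rep i) ≢ rep j
    head-rep-unmatched i j i<o partner≡ =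
      head-unmatched i j i<o j<o (trans partner-head≡rep-j (rep-head j j<o))
      where
      partner-head≡rep-j : partner (head i i<o) ≡ rep j
      partner-head≡rep-j = trans (cong partner (sym (rep-head i i<o))) partner≡
      j<o : toℕ j < o
      j<o = subst (_< o) (cong toℕ (trans (cong part partner-head≡rep-j) (rep-part j)))
              (head-partner-below i i<o)

    transversal : UnmatchedTransversal
    transversal = record
      { rep = rep
      ; rep-part = rep-part
      ; rep-unmatched = λ i j _ i∈W → case-split i j i∈W (toℕ i <? o)
      }
      where
      case-split : ∀ i j → inW s part (rep i) ≡ true → Dec (toℕ i < o) → partner (rep i) ≢ rep j
      case-split i j _   (yes i<o) = head-rep-unmatched i j i<o
      case-split i j i∈W (no i≮o)  = tail-rep-unmatched i j (≮⇒≥ i≮o) i∈W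

even-or-even-suc : ∀ p → Even p ⊎ Even (suc p)
even-or-even-suc zero    = inj₁ (divides 0 refl)
even-or-even-suc (suc p) with even-or-even-suc p
... | inj₁ even-p   = inj₂ (∣m∣n⇒∣m+n (∣-refl {2}) even-p)
... | inj₂ even-p+1 = inj₁ even-p+1

even⇒odd-suc : ∀ {p} → Even p → Odd (suc p)
even⇒odd-suc {p} even-p even-p+1 =
  2≢1 (∣1⇒≡1 (∣m+n∣m⇒∣n (subst (2 ∣_) (+-comm 1 p) even-p+1) even-p))
  where
  2≢1 : 2 ≢ 1
  2≢1 ()

odd-suc⇒even : ∀ p → Odd (suc p) → Even p
odd-suc⇒even p odd-p+1 with even-or-even-suc p
... | inj₁ even-p   = even-p
... | inj₂ even-p+1 = contradiction even-p+1 odd-p+1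

-- Case χ - b even: the matching joins the parts 0,1; 2,3; … of W, so the
-- pairs start at the even parts and nothing special happens below part 0.
even-case : ∀ {a b χ} → 2 ≤ a → Even (χ ∸ b) → (D : EvenData a b χ) →
  RχGraph (order a b χ ∸ suc a) χ (TStar.T (EvenData.P D))
even-case {a} {b} {χ} 2≤a s-even D = is-RχGraph matching transversal
  where
  open EvenData D
  open Partition P
  open TStar P
  open Pairing.Pairs P 2≤a 0 Even (2 ∣?_) (λ _ → even⇒odd-suc) odd-suc⇒even (divides 0 refl) s-even
         (λ v v∈W _ → matched v v∈W) (λ _ ()) (λ _ ()) (λ _ ()) (λ _ _ ())
  matching : GoodMatching
  matching = record
    { partner-in-W  = λ v v∈W → tail-in-W v v∈W z≤n
    ; partner-moves = λ v v∈W → tail-moves v v∈W z≤n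
    }

next3-<3 : ∀ p → p < 3 → next3 p < 3
next3-<3 0 _ = s<s z<s
next3-<3 1 _ = s<s (s<s z<s)
next3-<3 2 _ = z<s
next3-<3 (suc (suc (suc p))) (s<s (s<s (s<s ())))

next3-<3⁻¹ : ∀ q → next3 q < 3 → q < 3
next3-<3⁻¹ 0 _ = z<s
next3-<3⁻¹ 1 _ = s<s z<s
next3-<3⁻¹ 2 _ = s<s (s<s z<s)
next3-<3⁻¹ (suc (suc (suc q))) (s<s (s<s (s<s ())))

next3-≢ : ∀ q → next3 q ≢ q
next3-≢ 0 ()
next3-≢ 1 ()
next3-≢ 2 ()
next3-≢ (suc (suc (suc q))) = 1+n≢n

-- Case χ - b ≥ 3 odd: the first three parts are matched cyclically, from
-- the first half V′ of one part to the second half V″ of the next, and the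
-- parts 3,4; 5,6; … in pairs starting at the odd parts.  Below part 3 the
-- representatives are taken from the first halves V′: partners of such
-- vertices lie in second halves, so they are never representatives.
odd-case : ∀ {a b χ} → 2 ≤ a → Odd (χ ∸ b) → 3 ≤ χ ∸ b → (D : OddData a b χ) →
  RχGraph (order a b χ ∸ suc a) χ (TStar.T (OddData.P D))
odd-case {a} {b} {χ} 2≤a s-odd 3≤s D = is-RχGraph matching transversal
  where
  open OddData D
  open Partition P
  open TStar P

  first-half : ∀ i → toℕ i < 3 → Σ (Fin n) λ v → (inPart part i v ∧ half v) ≡ true
  first-half i i<3 = count-witness _ (subst (0 <_) (sym (half-size′ i i<3)) (m≥n⇒m/n>0 2≤a))

  head : ∀ i → toℕ i < 3 → Fin n
  head i i<3 = proj₁ (first-half i i<3)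

  head-part : ∀ i i<3 → part (head i i<3) ≡ i
  head-part i i<3 = does⇒ (part (head i i<3) Fin.≟ i) (proj₁ (∧-true (proj₂ (first-half i i<3))))

  head-half : ∀ i i<3 → half (head i i<3) ≡ true
  head-half i i<3 = proj₂ (∧-true (proj₂ (first-half i i<3)))

  head-<3 : ∀ i i<3 → toℕ (part (head i i<3)) < 3
  head-<3 i i<3 = subst (_< 3) (sym (cong toℕ (head-part i i<3))) i<3

  triangle-partner : ∀ v → toℕ (part v) < 3 → toℕ (part (partner v)) < 3
  triangle-partner v v<3 with half v in h
  ... | true  = subst (_< 3) (sym (proj₁ (matched-′ v v<3 h))) (next3-<3 _ v<3)
  ... | false = next3-<3⁻¹ _ (subst (_< 3) (sym (proj₁ (matched-″ v v<3 h))) v<3)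

  triangle-moves : ∀ v → toℕ (part v) < 3 → part (partner v) ≢ part v
  triangle-moves v v<3 same with half v in h
  ... | true  = next3-≢ _ (trans (sym (proj₁ (matched-′ v v<3 h))) (cong toℕ same))
  ... | false = next3-≢ _ (trans (proj₁ (matched-″ v v<3 h)) (sym (cong toℕ same)))

  head-partner-below : ∀ i i<3 → toℕ (part (partner (head i i<3))) < 3
  head-partner-below i i<3 = triangle-partner (head i i<3) (head-<3 i i<3)

  head-unmatched : ∀ i j i<3 j<3 → partner (head i i<3) ≢ head j j<3
  head-unmatched i j i<3 j<3 partner≡ = true≢false (begin
    true                         ≡⟨ sym (head-half j j<3) ⟩
    half (head j j<3)            ≡⟨ cong half (sym partner≡) ⟩
    half (partner (head i i<3))  ≡⟨ proj₂ (matched-′ (head i i<3) (head-<3 i i<3) (head-half i i<3)) ⟩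
    false                        ∎)
    where
    open ≡-Reasoning
    true≢false : true ≢ false
    true≢false ()

  paired-from-3 : ∀ v → inW s part v ≡ true → 3 ≤ toℕ (part v) →
    Paired Odd (toℕ (part v)) (toℕ (part (partner v)))
  paired-from-3 v v∈W 3≤v with matched-rest v v∈W 3≤v
  ... | inj₁ first-member          = inj₁ first-member
  ... | inj₂ (even-v , q+1≡p)      = inj₂ ((λ odd-v → odd-v even-v) , q+1≡p)

  odd⇒¬odd-suc : ∀ p → Odd p → ¬ Odd (suc p)
  odd⇒¬odd-suc p odd-p odd-p+1 = odd-p (odd-suc⇒even p odd-p+1)

  open Pairing.Pairs P 2≤a 3 Odd (λ p → ¬? (2 ∣? p)) odd⇒¬odd-suc
         (λ p ¬odd-p+1 even-p → ¬odd-p+1 (even⇒odd-suc even-p)) (even⇒odd-suc (divides 1 refl)) s-odd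
         paired-from-3 head head-part head-partner-below head-unmatched

  partner-in-W : ∀ v → inW s part v ≡ true → inW s part (partner v) ≡ true
  partner-in-W v v∈W with toℕ (part v) <? 3
  ... | yes v<3 = <⇒<ᵇ-true (≤-trans (triangle-partner v v<3) 3≤s)
  ... | no  v≮3 = tail-in-W v v∈W (≮⇒≥ v≮3)

  partner-moves : ∀ v → inW s part v ≡ true → part (partner v) ≢ part v
  partner-moves v v∈W with toℕ (part v) <? 3
  ... | yes v<3 = triangle-moves v v<3
  ... | no  v≮3 = tail-moves v v∈W (≮⇒≥ v≮3)

  matching : GoodMatching
  matching = record { partner-in-W = partner-in-W ; partner-moves = partner-moves }

-- A graph with chromatic number at least one has a vertex, as the empty
-- graph is 0-colourable.
chromatic-nonempty : ∀ {m c} (adj : Adj m) → ChromaticNumber (suc c) adj → 0 < m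
chromatic-nonempty {zero}  adj (_ , at-least) with () ← at-least 0 ((λ ()) , λ ())
chromatic-nonempty {suc m} adj _ = z<s

degree-identity : ∀ a c d → order a (suc d) (suc c) ∸ suc a ≡ a * c + d
degree-identity a c d = begin
  a * suc c + suc d ∸ suc a     ≡⟨ cong (_∸ suc a) rearrange ⟩
  suc a + (a * c + d) ∸ suc a   ≡⟨ m+n∸m≡n (suc a) (a * c + d) ⟩
  a * c + d                     ∎
  where
  open ≡-Reasoning
  rearrange : a * suc c + suc d ≡ suc a + (a * c + d)
  rearrange = solve (a ∷ c ∷ d ∷ [])

-- Which case applies is recorded in IsTStar itself.
theorem8 : (a b χ : ℕ) → 3 ≤ χ → b ≤ χ → 1 < b → 2 ≤ a →
    (Even (χ ∸ b) ⊎ (3 ≤ χ ∸ b × Odd (χ ∸ b) × Even a × 2 < a)) →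
    (adj : Adj (order a b χ)) → IsTStar a b χ adj →
    Extremal (a * (χ ∸ 1) + (b ∸ 1)) χ adj
theorem8 a zero    χ       _  _ ()  _   _ _   _
theorem8 a (suc d) zero    () _ _   _   _ _   _
theorem8 a (suc d) (suc c) _  _ 1<b 2≤a _ adj is-T* = is-RχGraph is-T* , minimal
  where
  with-degree : ∀ {T : Adj (order a (suc d) (suc c))} →
    RχGraph (order a (suc d) (suc c) ∸ suc a) (suc c) T → RχGraph (a * c + d) (suc c) T
  with-degree {T} = subst (λ r → RχGraph r (suc c) T) (degree-identity a c d)
  is-RχGraph : IsTStar a (suc d) (suc c) adj → RχGraph (a * c + d) (suc c) adj
  is-RχGraph (inj₁ (s-even , D , adj≡T*)) =
    RχGraph-cong adj≡T* (with-degree (even-case 2≤a s-even D))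
  is-RχGraph (inj₂ (s-odd , 3≤s , _ , D , adj≡T*)) =
    RχGraph-cong adj≡T* (with-degree (odd-case 2≤a s-odd 3≤s D))
  minimal : ∀ m (adj′ : Adj m) → RχGraph (a * c + d) (suc c) adj′ → order a (suc d) (suc c) ≤ m
  minimal m adj′ (_ , regular , chromatic) = order-bound-arith a c d m (≤-pred 1<b)
    (chromatic-nonempty adj′ chromatic) (order-bound adj′ regular (proj₁ chromatic))
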